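{- Let $\Sigma$ and $\widehat\Sigma$ be $\mathscr{P}$-partitions such that $\widehat\Sigma$ cart-imitates $\Sigma$ via a bijection $\beta:\Sigma\to\widehat\Sigma$. Then for all $X,Y,Z\subseteq\Sigma$: if $\bigcup X\supseteq\bigcup Y\otimes\bigcup Z$, then $\bigcup\beta[X]\supseteq\bigcup\beta[Y]\otimes\bigcup\beta[Z]$.
   Context: A partition is a collection of pairwise disjoint nonempty sets (blocks). A $\mathscr{P}$-partition is a partition $\Sigma$ containing a block $\sigma^*$ with $\bigcup(\Sigma\setminus\{\sigma^*\})\subseteq\bigcup\bigcup\Sigma\subseteq\mathcal P(\bigcup\bigcup\Sigma)=\bigcup\Sigma$. For a set $\Gamma$ of blocks, $\mathcal P^*(\Gamma)=\{s\subseteq\bigcup\Gamma: s\cap\sigma\neq\emptyset\text{ for all }\sigma\in\Gamma\}$, and $\mathcal P^*(\Gamma)_{1,2}$ is the set of its elements of cardinality $1$ or $2$. $A\otimes B=\{\{a,b\}:a\in A,b\in B\}$. $\widehat\Sigma$ weakly cart-imitates $\Sigma$ via a bijection $\beta$ if for all $X\subseteq\Sigma$, $\sigma\in\Sigma$: (i) $\mathcal P^*(\beta[X])\cap\beta(\sigma)\neq\emptyset$ implies $\mathcal P^*(X)\cap\sigma\neq\emptyset$; (ii) $\bigcup\beta[X]\in\beta(\sigma)$ iff $\bigcup X\in\sigma$; (iii) $\mathcal P^*(\beta[X])_{1,2}\cap\beta(\sigma)\neq\emptyset$ iff $\mathcal P^*(X)_{1,2}\cap\sigma\neq\emptyset$,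 and $(\mathcal P^*(\beta[X])\setminus\mathcal P^*(\beta[X])_{1,2})\cap\beta(\sigma)\neq\emptyset$ iff $(\mathcal P^*(X)\setminus\mathcal P^*(X)_{1,2})\cap\sigma\neq\emptyset$. $\widehat\Sigma$ cart-imitates $\Sigma$ via $\beta$ if it weakly cart-imitates it via $\beta$ and moreover (iv) for every $X\subseteq\Sigma$, if $\mathcal P^*(X)_{1,2}\subseteq\bigcup\Sigma$ then $\mathcal P^*(\beta[X])_{1,2}\subseteq\bigcup\beta[\Sigma]$. -}

module Defs where

open import Data.Product using (Σ; ∃; _×_; _,_)
open import Data.Sum using (_⊎_)
open import Relation.Nullary using (¬_)
open import Relation.Binary.PropositionalEquality using (_≡_; _≢_)

_iff_ : Set → Set → Set
A iff B = (A → B) × (B → A)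

record ZFModel : Set₁ where
  field
    V   : Set
    _∈_ : V → V → Set
    extensionality : ∀ x y → (∀ z → (z ∈ x) iff (z ∈ y)) → x ≡ y
    pairing     : ∀ a b → ∃ λ p → ∀ z → (z ∈ p) iff ((z ≡ a) ⊎ (z ≡ b))
    union       : ∀ A → ∃ λ u → ∀ z → (z ∈ u) iff (∃ λ a → (a ∈ A) × (z ∈ a))
    replacement : ∀ (f : V → V) A → ∃ λ B → ∀ z → (z ∈ B) iff (∃ λ a → (a ∈ A) × (z ≡ f a))
    separation  : ∀ (P : V → Set) A → ∃ λ B → ∀ z → (z ∈ B) iff ((z ∈ A) × P z)
    excludedMiddle : (P : Set) → P ⊎ ¬ P

module _ (M : ZFModel) where
  open ZFModel M

  Class : Set₁
  Class = V → Set

  mem : V → Class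
  mem X = λ z → z ∈ X

  img : (V → V) → V → Class
  img β X = λ γ → ∃ λ x → (x ∈ X) × (γ ≡ β x)

  _⊆_ : V → V → Set
  A ⊆ B = ∀ z → z ∈ A → z ∈ B

  InUnion : Class → V → Set
  InUnion Γ z = ∃ λ a → Γ a × (z ∈ a)

  IsUnion : V → Class → Set
  IsUnion u Γ = ∀ z → (z ∈ u) iff InUnion Γ z

  UnionIn : Class → V → Set
  UnionIn Γ σ = ∃ λ u → IsUnion u Γ × (u ∈ σ)

  IsPair : V → V → V → Set
  IsPair p a b = ∀ z → (z ∈ p) iff ((z ≡ a) ⊎ (z ≡ b))

  -- |s| ∈ {1,2}
  Card12 : V → Set
  Card12 s = ∃ λ a → ∃ λ b → IsPair s a b

  -- p ∈ A ⊗ B  where A = ⋃Γ, B = ⋃Δ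
  InTensorUnion : Class → Class → V → Set
  InTensorUnion Γ Δ p = ∃ λ a → ∃ λ b → InUnion Γ a × InUnion Δ b × IsPair p a b

  InPstar : Class → V → Set
  InPstar Γ s = (∀ y → y ∈ s → InUnion Γ y) × (∀ γ → Γ γ → ∃ λ y → (y ∈ s) × (y ∈ γ))

  Partition : V → Set
  Partition S =
    (∀ σ → σ ∈ S → ∃ λ z → z ∈ σ) ×
    (∀ σ τ → σ ∈ S → τ ∈ S → ∀ z → z ∈ σ → z ∈ τ → σ ≡ τ)

  InUU : V → V → Set
  InUU S x = ∃ λ s → InUnion (mem S) s × (x ∈ s)

  PPartition : V → Set
  PPartition S = Partition S × ∃ λ σ* → (σ* ∈ S) ×
    (∀ σ → σ ∈ S → σ ≢ σ* → ∀ s → s ∈ σ → InUU S s) ×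
    (∀ x → InUU S x → ∀ y → y ∈ x → InUU S y) ×
    (∀ s → (∀ y → y ∈ s → InUU S y) iff InUnion (mem S) s)

  BijectionOn : (V → V) → V → V → Set
  BijectionOn β S Ŝ =
    (∀ σ → σ ∈ S → β σ ∈ Ŝ) ×
    (∀ σ τ → σ ∈ S → τ ∈ S → β σ ≡ β τ → σ ≡ τ) ×
    (∀ τ → τ ∈ Ŝ → ∃ λ σ → (σ ∈ S) × (β σ ≡ τ))

  WeaklyCartImitates : V → V → (V → V) → Set
  WeaklyCartImitates Ŝ S β = ∀ X → X ⊆ S → ∀ σ → σ ∈ S →
    ((∃ λ s → InPstar (img β X) s × (s ∈ β σ)) → (∃ λ s → InPstar (mem X) s × (s ∈ σ))) ×
    (UnionIn (img β X) (β σ) iff UnionIn (mem X) σ) ×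
    -- (iii)
    ((∃ λ s → InPstar (img β X) s × Card12 s × (s ∈ β σ))
       iff (∃ λ s → InPstar (mem X) s × Card12 s × (s ∈ σ))) ×
    ((∃ λ s → InPstar (img β X) s × ¬ Card12 s × (s ∈ β σ))
       iff (∃ λ s → InPstar (mem X) s × ¬ Card12 s × (s ∈ σ)))

  CartImitates : V → V → (V → V) → Set
  CartImitates Ŝ S β = WeaklyCartImitates Ŝ S β ×
    -- (iv)
    (∀ X → X ⊆ S →
      (∀ s → InPstar (mem X) s → Card12 s → InUnion (mem S) s) →
      (∀ s → InPstar (img β X) s → Card12 s → InUnion (img β S) s))

-- Put P = {y, z} for y ∈ Y, z ∈ Z. Every s ∈ 𝒫*(P)₁,₂ is a pair straddling y and z, hence
-- lies in ⋃Y ⊗ ⋃Z ⊆ ⋃X ⊆ ⋃Σ, so (iv) places every p = {a, b} with a ∈ β y, b ∈ β z, which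
-- lies in 𝒫*(β[P])₁,₂, in some block β σ. By (iii) σ also meets 𝒫*(P)₁,₂, in some s, and
-- s ∈ ⋃X; as the blocks of Σ are disjoint, σ ∈ X, so p ∈ ⋃β[X].
module Submission where

open import Defs
open import Data.Product using (∃; _×_; _,_; proj₁; proj₂)
open import Data.Sum using (_⊎_; inj₁; inj₂; swap)
open import Relation.Binary.PropositionalEquality using (refl)

module _ (M : ZFModel) where
  open ZFModel M

  IsPair-swap : ∀ {p a b} → IsPair M p a b → IsPair M p b a
  IsPair-swap p≡ab w = (λ w∈p → swap (proj₁ (p≡ab w) w∈p)) , (λ w≡ → proj₂ (p≡ab w) (swap w≡))

  IsPair-fst : ∀ {p a b} → IsPair M p a b → a ∈ p
  IsPair-fst p≡ab = proj₂ (p≡ab _) (inj₁ refl)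

  IsPair-snd : ∀ {p a b} → IsPair M p a b → b ∈ p
  IsPair-snd p≡ab = proj₂ (p≡ab _) (inj₂ refl)

  IsPair-⊆ : ∀ {p a b A} → IsPair M p a b → a ∈ A → b ∈ A → _⊆_ M p A
  IsPair-⊆ p≡ab a∈A b∈A w w∈p with proj₁ (p≡ab w) w∈p
  ... | inj₁ refl = a∈A
  ... | inj₂ refl = b∈A

  IsPair-reorder : ∀ {s c d e} → IsPair M s c d → e ∈ s → ∃ λ d′ → IsPair M s e d′
  IsPair-reorder {d = d} s≡cd e∈s with proj₁ (s≡cd _) e∈s
  ... | inj₁ refl = d , s≡cd
  ... | inj₂ refl = _ , IsPair-swap s≡cd

  Card12-straddle : ∀ {s y z} → Card12 M s →
    (∀ w → w ∈ s → (w ∈ y) ⊎ (w ∈ z)) →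
    (∃ λ e → (e ∈ s) × (e ∈ y)) → (∃ λ f → (f ∈ s) × (f ∈ z)) →
    ∃ λ a → ∃ λ b → (a ∈ y) × (b ∈ z) × IsPair M s a b
  Card12-straddle (c , d , s≡cd) s⊆y∪z (e , e∈s , e∈y) (f , f∈s , f∈z)
    with IsPair-reorder s≡cd e∈s
  ... | d′ , s≡ed′ with proj₁ (s≡ed′ f) f∈s
  ...   | inj₂ refl = e , f , e∈y , f∈z , s≡ed′
  ...   | inj₁ refl with s⊆y∪z d′ (IsPair-snd s≡ed′)
  ...     | inj₁ d′∈y = d′ , e , d′∈y , f∈z , IsPair-swap s≡ed′
  ...     | inj₂ d′∈z = e , d′ , e∈y , d′∈z , s≡ed′

  Pstar₁₂-pair⇒tensor : ∀ {Γ Δ : Class M} {P y z s} → Γ y → Δ z → IsPair M P y z →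
    InPstar M (mem M P) s → Card12 M s → InTensorUnion M Γ Δ s
  Pstar₁₂-pair⇒tensor {y = y} {z} Γy Δz P≡yz (s⊆⋃P , s-meets) s₁₂
    with Card12-straddle s₁₂ s⊆y∪z (s-meets y (IsPair-fst P≡yz)) (s-meets z (IsPair-snd P≡yz))
    where
    s⊆y∪z : ∀ w → w ∈ _ → (w ∈ y) ⊎ (w ∈ z)
    s⊆y∪z w w∈s with s⊆⋃P w w∈s
    ... | x , x∈P , w∈x with proj₁ (P≡yz x) x∈P
    ...   | inj₁ refl = inj₁ w∈x
    ...   | inj₂ refl = inj₂ w∈x
  ... | a , b , a∈y , b∈z , s≡ab = a , b , (y , Γy , a∈y) , (z , Δz , b∈z) , s≡ab

  pair-∈-Pstar-img : ∀ {β P y z p a b} → IsPair M P y z → IsPair M p a b →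
    a ∈ β y → b ∈ β z → InPstar M (img M β P) p
  pair-∈-Pstar-img {β} {y = y} {z} {a = a} {b} P≡yz p≡ab a∈βy b∈βz = p⊆⋃βP , p-meets
    where
    p⊆⋃βP : ∀ w → w ∈ _ → InUnion M (img M β _) w
    p⊆⋃βP w w∈p with proj₁ (p≡ab w) w∈p
    ... | inj₁ refl = β y , (y , IsPair-fst P≡yz , refl) , a∈βy
    ... | inj₂ refl = β z , (z , IsPair-snd P≡yz , refl) , b∈βz
    p-meets : ∀ γ → img M β _ γ → ∃ λ w → (w ∈ _) × (w ∈ γ)
    p-meets γ (x , x∈P , refl) with proj₁ (P≡yz x) x∈P
    ... | inj₁ refl = a , IsPair-fst p≡ab , a∈βy
    ... | inj₂ refl = b , IsPair-snd p≡ab , b∈βz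

  Pstar₁₂-⊆-⋃-img : ∀ {S Ŝ β X P} → Partition M S → CartImitates M Ŝ S β →
    _⊆_ M X S → _⊆_ M P S →
    (∀ s → InPstar M (mem M P) s → Card12 M s → InUnion M (mem M X) s) →
    ∀ p → InPstar M (img M β P) p → Card12 M p → InUnion M (img M β X) p
  Pstar₁₂-⊆-⋃-img {S} {β = β} (_ , disjoint) (weakly , iv) X⊆S P⊆S Pstar₁₂⊆⋃X p p∈𝒫* p₁₂
    with iv _ P⊆S Pstar₁₂⊆⋃S p p∈𝒫* p₁₂
    where
    Pstar₁₂⊆⋃S : ∀ s → InPstar M (mem M _) s → Card12 M s → InUnion M (mem M S) s
    Pstar₁₂⊆⋃S s s∈𝒫* s₁₂ with Pstar₁₂⊆⋃X s s∈𝒫* s₁₂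
    ... | x , x∈X , s∈x = x , X⊆S x x∈X , s∈x
  ... | _ , (σ , σ∈S , refl) , p∈βσ with weakly _ P⊆S σ σ∈S
  ...   | _ , _ , (card12-reflect , _) , _ with card12-reflect (p , p∈𝒫* , p₁₂ , p∈βσ)
  ...     | s , s∈𝒫* , s₁₂ , s∈σ with Pstar₁₂⊆⋃X s s∈𝒫* s₁₂
  ...       | x , x∈X , s∈x with disjoint σ x σ∈S (X⊆S x x∈X) s s∈σ s∈x
  ...         | refl = β σ , (σ , x∈X , refl) , p∈βσ

mainTheorem3 : (M : ZFModel) → let open ZFModel M in
    ∀ (S Ŝ : V) (β : V → V) →
      PPartition M S → PPartition M Ŝ →
      BijectionOn M β S Ŝ → CartImitates M Ŝ S β →
      ∀ X Y Z → _⊆_ M X S → _⊆_ M Y S → _⊆_ M Z S →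
      (∀ p → InTensorUnion M (mem M Y) (mem M Z) p → InUnion M (mem M X) p) →
      (∀ p → InTensorUnion M (img M β Y) (img M β Z) p → InUnion M (img M β X) p)
mainTheorem3 M S Ŝ β (S-partition , _) _ _ imitates X Y Z X⊆S Y⊆S Z⊆S ⊗⊆⋃X p
  (a , b , (_ , (y , y∈Y , refl) , a∈βy) , (_ , (z , z∈Z , refl) , b∈βz) , p≡ab) =
  -- Ŝ does not occur in the unfolded CartImitates, so it cannot be inferred.
  Pstar₁₂-⊆-⋃-img M {Ŝ = Ŝ} S-partition imitates X⊆S P⊆S
    (λ s s∈𝒫* s₁₂ → ⊗⊆⋃X s (Pstar₁₂-pair⇒tensor M y∈Y z∈Z P≡yz s∈𝒫* s₁₂))
    p (pair-∈-Pstar-img M P≡yz p≡ab a∈βy b∈βz) (a , b , p≡ab)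
  where
  open ZFModel M
  P≡yz : IsPair M (proj₁ (pairing y z)) y z
  P≡yz = proj₂ (pairing y z)
  P⊆S : _⊆_ M (proj₁ (pairing y z)) S
  P⊆S = IsPair-⊆ M P≡yz (Y⊆S y y∈Y) (Z⊆S z z∈Z)
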